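{- Let $c$ be a Coxeter element of $\widehat{\mathfrak S}_n$ and let $\prec_1,\prec_2$ be two $c$-sortable TITOs on $\mathbb Z$. Then $\prec_1=\prec_2$ if and only if $\mathrm{Cov}(\prec_1)=\mathrm{Cov}(\prec_2)$.
   Context: A Coxeter element $c$ of $\widehat{\mathfrak S}_n$ (product, once each in some order, of the simple generators $s_i$, $0\le i\le n-1$, exchanging $i+mn$ and $i+1+mn$ for all $m$) moves every integer; $\overline{L_c}=\{x:c(x)>x\}$, $\overline{R_c}=\{x:c(x)<x\}$. A (real) TITO on $\mathbb Z$ is a total order $\prec$ on $\mathbb Z$ with $x\prec y\iff x+n\prec y+n$ and no cover relation of the form $x+n\prec x$. Having finitely many elements $\prec$-between them is an equivalence relation; its classes (blocks) are $\prec$-intervals which are unions of residue classes mod $n$, linearly ordered; a block is waning if $x+n\prec x$ for its elements and waxing otherwise. $\prec$ is $c$-sortable if (1) either it consists of a single waxing block, or its blocks are, in order, possibly a waxing block contained in $\overline{L_c}$, a waning block meeting both $\overline{L_c}$ and $\overline{R_c}$, and possibly a waxing block contained in $\overline{R_c}$, with no other blocks; and (2) there are no $i<j<k$ with $k\prec i\prec j$ and $j\in\overline{L_c}$, nor with $j\prec k\prec i$ and $j\in\overline{R_c}$. $\mathrm{Cov}(\prec)$ is the set of affine transpositions $(p,q)$ (exchanging $p+mn,q+mn$ for all $m$) with $p<q$, $p\not\equiv q\pmod n$, such that $q$ is the immediate predecessor of $p$ in $\prec$. -}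

module Defs where

open import Data.Nat as ℕ using (ℕ)
open import Data.Nat.Divisibility as ℕD using ()
open import Data.Integer using (ℤ; +_; _+_; _-_; _*_; ∣_∣; _<_; _>_)
open import Data.Fin using (Fin; toℕ)
open import Data.List using (List; foldr)
open import Data.List.Membership.Propositional using (_∈_)
open import Data.Product using (Σ; ∃; _×_)
open import Data.Sum using (_⊎_)
open import Function using (id; _∘_)
open import Relation.Nullary using (¬_; yes; no)
open import Relation.Binary.PropositionalEquality using (_≡_)
open import Relation.Binary.Structures using (IsStrictTotalOrder)

Cong : ℕ → ℤ → ℤ → Set
Cong n x y = n ℕD.∣ ∣ x - y ∣

-- simple generator s_i of the affine symmetric group: exchanges i + mn and i+1+mn
s : (n : ℕ) → Fin n → ℤ → ℤ
s n i x with n ℕD.∣? ∣ x - + toℕ i ∣ | n ℕD.∣? ∣ x - + ℕ.suc (toℕ i) ∣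
... | yes _ | _     = x + + 1
... | no _  | yes _ = x - + 1
... | no _  | no _  = x

-- the product s_{i₁} s_{i₂} ⋯ s_{iₖ} of the generators listed in a word, as a map ℤ → ℤ
-- (composition of maps: the rightmost letter acts first)
wordPerm : (n : ℕ) → List (Fin n) → ℤ → ℤ
wordPerm n = foldr (λ i f → s n i ∘ f) id

-- affine transposition (p,q) (for p ≢ q mod n): exchanges p + mn and q + mn for all m
transp : (n : ℕ) → ℤ → ℤ → ℤ → ℤ
transp n p q x with n ℕD.∣? ∣ x - p ∣ | n ℕD.∣? ∣ x - q ∣
... | yes _ | _     = x + (q - p)
... | no _  | yes _ = x + (p - q)
... | no _  | no _  = x

module _ (n : ℕ) (c : ℤ → ℤ) (_≺_ : ℤ → ℤ → Set) where

  Lc : ℤ → Set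
  Lc x = c x > x

  Rc : ℤ → Set
  Rc x = c x < x

  Covers : ℤ → ℤ → Set
  Covers y x = y ≺ x × (∀ z → ¬ (y ≺ z × z ≺ x))

  record IsTITO : Set where
    field
      strictTotal : IsStrictTotalOrder _≡_ _≺_
      translate   : ∀ x y → (x ≺ y → (x + + n) ≺ (y + + n)) × ((x + + n) ≺ (y + + n) → x ≺ y)
      noCover     : ∀ x → ¬ Covers (x + + n) x

  Between : ℤ → ℤ → ℤ → Set
  Between x y z = (x ≺ z × z ≺ y) ⊎ (y ≺ z × z ≺ x)

  SameBlock : ℤ → ℤ → Set
  SameBlock x y = Σ (List ℤ) λ L → ∀ z → Between x y z → z ∈ L

  BlockWaning : ℤ → Set
  BlockWaning x = ∀ y → SameBlock x y → (y + + n) ≺ y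

  BlockWaxing : ℤ → Set
  BlockWaxing x = ¬ BlockWaning x

  SingleWaxingBlock : Set
  SingleWaxingBlock = (∀ x y → SameBlock x y) × (∀ x → BlockWaxing x)

  LeftBlockElt : ℤ → ℤ → Set
  LeftBlockElt w x = x ≺ w × Lc x × BlockWaxing x
                     × (∀ y → y ≺ w → ¬ SameBlock y w → SameBlock x y)

  RightBlockElt : ℤ → ℤ → Set
  RightBlockElt w x = w ≺ x × Rc x × BlockWaxing x
                      × (∀ y → w ≺ y → ¬ SameBlock y w → SameBlock x y)

  -- condition (1): (waxing block ⊆ L_c)? , waning block meeting L_c and R_c , (waxing block ⊆ R_c)?
  ThreeBlocks : Set
  ThreeBlocks = Σ ℤ λ w → BlockWaning w
                × (∃ λ a → SameBlock w a × Lc a)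
                × (∃ λ b → SameBlock w b × Rc b)
                × (∀ x → ¬ SameBlock w x → LeftBlockElt w x ⊎ RightBlockElt w x)

  Cond2 : Set
  Cond2 = ∀ i j k → i < j → j < k →
          ¬ (k ≺ i × i ≺ j × Lc j) × ¬ (j ≺ k × k ≺ i × Rc j)

  Sortable : Set
  Sortable = (SingleWaxingBlock ⊎ ThreeBlocks) × Cond2

  CovPair : ℤ → ℤ → Set
  CovPair p q = p < q × ¬ Cong n p q × Covers q p

  InCov : (ℤ → ℤ) → Set
  InCov t = Σ ℤ λ p → Σ ℤ λ q → CovPair p q × (∀ x → t x ≡ transp n p q x)

-- Coxeter elements: products of s_0,…,s_{n-1}, each exactly once, in some order
-- (encoded by the word, a permutation of the list of all generators)

module Submission where

-- Only "Cov(≺₁) = Cov(≺₂) implies ≺₁ = ≺₂" needs an argument, and two total orders on ℤ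
-- coincide as soon as they have the same inversions b ≺ a, a < b.
--
-- A Coxeter element moves every integer, so every j lies in L_c or R_c.  A cover u ≺ v with
-- v < u gives a pair of Cov, and an affine transposition determines its pair up to
-- translation by a multiple of n; so such covers are common to ≺₁ and ≺₂.  An inversion
-- u ≺₁ v with finitely many elements ≺₁-between then transfers by induction on them: an
-- element z between with v < z < u splits the inversion in two; if z < v (resp. z > u),
-- condition (2) for ≺₁ puts v in R_c (resp. u in L_c), and condition (2) for ≺₂ turns the
-- shorter inversion u ≺₂ z (resp. z ≺₂ v) into u ≺₂ v.
--
-- For x + n ≺₁ x this shows that both orders have the same waning elements.  Hence their
-- blocks agree (the waning block, the waxing elements of L_c, those of R_c), and an
-- inversion across two blocks is decided by the order of the blocks.

open import Defs
open import Data.Nat as ℕ using (ℕ; _≤_; suc; zero)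
import Data.Nat.Properties as ℕP
import Data.Nat.Divisibility as ℕD
open import Data.Nat.DivMod using (m<n⇒m%n≡m)
open import Data.Integer as ℤ using (ℤ; +_; -[1+_]; 0ℤ; 1ℤ; _+_; _-_; _*_; -_; ∣_∣; _<_)
import Data.Integer.Properties as ℤP
open import Data.Integer.Divisibility.Signed using (divides; ∣ᵤ⇒∣; ∣⇒∣ᵤ; ∣m∣n⇒∣m-n)
  renaming (_∣_ to _∣ℤ_)
open import Data.Integer.DivMod using (_/ℕ_; _%ℕ_; n%ℕd<d; a≡a%ℕn+[a/ℕn]*n)
open import Data.Integer.Tactic.RingSolver using (solve-∀)
open import Algebra.Properties.AbelianGroup ℤP.+-0-abelianGroup using () renaming (∙-cancelˡ to +-cancelˡ)
open import Data.Fin using (Fin; toℕ; fromℕ<)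
open import Data.Fin.Properties as Fin using (toℕ<n; toℕ-fromℕ<; toℕ-injective; pigeonhole)
open import Data.List using (List; []; _∷_; _++_; allFin; length; lookup)
open import Data.List.Membership.Propositional using (_∈_)
open import Data.List.Membership.Propositional.Properties using (∈-allFin; ∈-++⁺ˡ; ∈-++⁺ʳ)
open import Data.List.Relation.Unary.Any using (here; there; index; tail)
open import Data.List.Relation.Unary.Any.Properties using (lookup-index)
open import Data.List.Relation.Unary.All as All using (All; []; _∷_)
open import Data.List.Relation.Unary.AllPairs using ([]; _∷_)
open import Data.List.Relation.Unary.Unique.Propositional using (Unique)
open import Data.List.Relation.Unary.Unique.Propositional.Properties using (allFin⁺)
open import Data.List.Relation.Binary.Permutation.Propositional using (_↭_; ↭-sym; ↭⇒↭ₛ)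
open import Data.List.Relation.Binary.Permutation.Propositional.Properties using (∈-resp-↭)
open import Data.List.Relation.Binary.Permutation.Setoid.Properties using (Unique-resp-↭)
open import Data.Product using (∃; _×_; _,_; proj₁; proj₂)
open import Data.Sum using (_⊎_; inj₁; inj₂; [_,_]′)
open import Effect.Monad using (RawMonad)
open import Function using (_∘_; id; case_of_; _⇔_; mk⇔; Equivalence)
open import Function.Definitions using (Injective)
open import Relation.Nullary using (¬_; yes; no)
open import Relation.Nullary.Negation using (contradiction; ¬¬-Monad; ¬¬-map)
open import Relation.Nullary.Decidable using (¬¬-excluded-middle; decidable-stable; _×-dec_)
open import Relation.Binary.Definitions using (tri<; tri≈; tri>)
open import Relation.Binary.Structures using (IsStrictTotalOrder)
open import Relation.Binary.PropositionalEquality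

i<i+j : ∀ i {j} → 0ℤ < j → i < i + j
i<i+j i 0<j = subst (_< i + _) (ℤP.+-identityʳ i) (ℤP.+-monoʳ-< i 0<j)

i+j<i : ∀ i {j} → j < 0ℤ → i + j < i
i+j<i i j<0 = subst (i + _ <_) (ℤP.+-identityʳ i) (ℤP.+-monoʳ-< i j<0)

i<i+1 : ∀ {i} → i < i + 1ℤ
i<i+1 {i} = i<i+j i (ℤ.+<+ ℕP.0<1+n)

i-1<i : ∀ {i} → i - 1ℤ < i
i-1<i {i} = i+j<i i ℤ.-<+

i<j⇒i-j<0 : ∀ {i j} → i < j → i - j < 0ℤ
i<j⇒i-j<0 {i} {j} i<j = subst (i - j <_) (ℤP.+-inverseʳ j) (ℤP.+-monoˡ-< (- j) i<j)

module Congruence (n : ℕ) {{_ : ℕ.NonZero n}} where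

  -- Signed divisibility, so that congruences can be rearranged with the ring solver.
  infix 4 _≋_
  _≋_ : ℤ → ℤ → Set
  x ≋ y = + n ∣ℤ x - y

  Cong⇒≋ : ∀ x y → Cong n x y → x ≋ y
  Cong⇒≋ x y = ∣ᵤ⇒∣

  ι : Fin n → ℤ
  ι i = + toℕ i

  residue-unique : ∀ x {i j : Fin n} → x ≋ ι i → x ≋ ι j → i ≡ j
  residue-unique x {i} {j} x≋i x≋j =
    toℕ-injective (ℤP.+-injective (ℤP.i-j≡0⇒i≡j _ _ (ℤP.∣i∣≡0⇒i≡0 distance≡0)))
    where
      difference : + n ∣ℤ ι i - ι j
      difference = subst (+ n ∣ℤ_) (cancel x (ι j) (ι i)) (∣m∣n⇒∣m-n x≋j x≋i)
        where cancel : ∀ x a b → (x - a) - (x - b) ≡ b - a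
              cancel = solve-∀
      small : ∣ ι i - ι j ∣ ℕ.< n
      small = ℕP.≤-<-trans
        (subst (ℕ._≤ toℕ i ℕ.⊔ toℕ j) (cong ∣_∣ (sym (ℤP.m-n≡m⊖n (toℕ i) (toℕ j)))) (ℤP.∣m⊝n∣≤m⊔n (toℕ i) (toℕ j)))
        (ℕP.⊔-lub (toℕ<n i) (toℕ<n j))
      distance≡0 : ∣ ι i - ι j ∣ ≡ 0
      distance≡0 = trans (sym (m<n⇒m%n≡m small)) (ℕD.n∣m⇒m%n≡0 _ n (∣⇒∣ᵤ difference))

  difference≡distance : ∀ {x y} → x < y → y - x ≡ + ∣ x - y ∣
  difference≡distance x<y = sym (ℤP.∣-∣-≤ (ℤP.<⇒≤ x<y))

  Cong-refl : ∀ x → Cong n x x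
  Cong-refl x = subst (n ℕD.∣_) (sym (cong ∣_∣ (ℤP.+-inverseʳ x))) (n ℕD.∣0)

  congruent-above : ∀ {x y} → x < y → Cong n x y → ∃ λ m → y ≡ x + + suc m * + n
  congruent-above {x} {y} x<y (ℕD.divides zero ∣x-y∣≡0) =
    contradiction (ℤP.i-j≡0⇒i≡j y x (trans (difference≡distance x<y) (cong +_ ∣x-y∣≡0))) (ℤP.<⇒≢ x<y ∘ sym)
  congruent-above {x} {y} x<y (ℕD.divides (suc m) ∣x-y∣≡k*n) = m , (begin
    y                        ≡⟨ split x y ⟩
    x + (y - x)              ≡⟨ cong (λ d → x + d) (difference≡distance x<y) ⟩
    x + + ∣ x - y ∣          ≡⟨ cong (λ d → x + + d) ∣x-y∣≡k*n ⟩
    x + + (suc m ℕ.* n)      ≡⟨ cong (λ d → x + d) (ℤP.pos-* (suc m) n) ⟩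
    x + + suc m * + n        ∎)
    where open ≡-Reasoning
          split : ∀ x y → y ≡ x + (y - x)
          split = solve-∀

  residue : ∀ x → ∃ λ (r : Fin n) → x ≋ ι r
  residue x = fromℕ< (n%ℕd<d x n) , divides (x /ℕ n) x-r≡q*n
    where
      x-r≡q*n : x - ι (fromℕ< (n%ℕd<d x n)) ≡ (x /ℕ n) * + n
      x-r≡q*n rewrite toℕ-fromℕ< (n%ℕd<d x n) =
        trans (cong (_- + (x %ℕ n)) (a≡a%ℕn+[a/ℕn]*n x n)) (cancel (+ (x %ℕ n)) ((x /ℕ n) * + n))
        where cancel : ∀ r m → (r + m) - r ≡ m
              cancel = solve-∀

  data TranspositionView (p q x : ℤ) : ℤ → Set where
    at-p  : Cong n x p → TranspositionView p q x (x + (q - p))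
    at-q  : ¬ Cong n x p → TranspositionView p q x (x + (p - q))
    fixed : ¬ Cong n x p → TranspositionView p q x x

  transposition-view : ∀ p q x → TranspositionView p q x (transp n p q x)
  transposition-view p q x with n ℕD.∣? ∣ x - p ∣ | n ℕD.∣? ∣ x - q ∣
  ... | yes x≡p | _     = at-p x≡p
  ... | no x≢p  | yes _ = at-q x≢p
  ... | no x≢p  | no _  = fixed x≢p

  transp-at-p : ∀ p q → transp n p q p ≡ q
  transp-at-p p q with transp n p q p | transposition-view p q p
  ... | _ | at-p _   = cancel p q
    where cancel : ∀ p q → p + (q - p) ≡ q
          cancel = solve-∀
  ... | _ | at-q p≢p  = contradiction (Cong-refl p) p≢p
  ... | _ | fixed p≢p = contradiction (Cong-refl p) p≢p

module Coxeter (n : ℕ) {{_ : ℕ.NonZero n}} where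
  open Congruence n

  data GeneratorView (i : Fin n) (y : ℤ) : ℤ → Set where
    raise : y ≋ ι i → GeneratorView i y (y + 1ℤ)
    lower : y - 1ℤ ≋ ι i → GeneratorView i y (y - 1ℤ)
    keep  : ¬ y ≋ ι i → GeneratorView i y y

  generator-view : ∀ i y → GeneratorView i y (s n i y)
  generator-view i y with n ℕD.∣? ∣ y - ι i ∣ | n ℕD.∣? ∣ y - + suc (toℕ i) ∣
  ... | yes y≡i | _        = raise (Cong⇒≋ y (ι i) y≡i)
  ... | no y≢i  | yes y≡i+1 = lower (subst (+ n ∣ℤ_) (shift y (ι i)) (Cong⇒≋ y _ y≡i+1))
    where shift : ∀ y k → y - (1ℤ + k) ≡ (y - 1ℤ) - k
          shift = solve-∀
  ... | no y≢i  | no _      = keep (λ y≡i → y≢i (∣⇒∣ᵤ {i = y - ι i} y≡i))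

  -- Where the letters of a word w with distinct letters have taken x: each s_j moves x at
  -- most once, and afterwards x stays on the side it was pushed to.
  data Displacement (w : List (Fin n)) (x : ℤ) : ℤ → Set where
    fixed : All (λ j → ¬ x ≋ ι j) w → Displacement w x x
    up    : ∀ {y j} → j ∈ w → x < y → y - 1ℤ ≋ ι j → Displacement w x y
    down  : ∀ {y j} → j ∈ w → y < x → y ≋ ι j → Displacement w x y

  raised-residue : ∀ y {i} → y ≋ ι i → (y + 1ℤ) - 1ℤ ≋ ι i
  raised-residue y {i} = subst (_≋ ι i) (sym (cancel y))
    where cancel : ∀ y → (y + 1ℤ) - 1ℤ ≡ y
          cancel = solve-∀

  displacement-step : ∀ {i w x y} → All (i ≢_) w → Displacement w x y → Displacement (i ∷ w) x (s n i y)
  displacement-step {i} {y = y} fresh d with s n i y | generator-view i y | d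
  ... | _ | raise y≡i   | fixed _          = up (here refl) i<i+1 (raised-residue y y≡i)
  ... | _ | lower y-1≡i | fixed _          = down (here refl) i-1<i y-1≡i
  ... | _ | keep y≢i    | fixed unmoved    = fixed (y≢i ∷ unmoved)
  ... | _ | raise y≡i   | up _ x<y _       = up (here refl) (ℤP.<-trans x<y i<i+1) (raised-residue y y≡i)
  ... | _ | lower y-1≡i | up j∈w _ y-1≡j   = contradiction (residue-unique (y - 1ℤ) y-1≡i y-1≡j) (All.lookup fresh j∈w)
  ... | _ | keep _      | up j∈w x<y y-1≡j = up (there j∈w) x<y y-1≡j
  ... | _ | raise y≡i   | down j∈w _ y≡j   = contradiction (residue-unique y y≡i y≡j) (All.lookup fresh j∈w)
  ... | _ | lower y-1≡i | down _ y<x _     = down (here refl) (ℤP.<-trans i-1<i y<x) y-1≡i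
  ... | _ | keep _      | down j∈w y<x y≡j = down (there j∈w) y<x y≡j

  displacement : ∀ w → Unique w → ∀ x → Displacement w x (wordPerm n w x)
  displacement []      _             x = fixed []
  displacement (i ∷ w) (fresh ∷ uniq) x = displacement-step fresh (displacement w uniq x)

  coxeter-moves : ∀ {w} → w ↭ allFin n → ∀ x → x < wordPerm n w x ⊎ wordPerm n w x < x
  coxeter-moves {w} w↭ x with wordPerm n w x | displacement w unique x
    where unique : Unique w
          unique = Unique-resp-↭ (setoid (Fin n)) (↭⇒↭ₛ (↭-sym w↭)) (allFin⁺ n)
  ... | _ | fixed unmoved  =
        contradiction (proj₂ (residue x)) (All.lookup unmoved (∈-resp-↭ (↭-sym w↭) (∈-allFin _)))
  ... | _ | up _ x<y _    = inj₁ x<y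
  ... | _ | down _ y<x _  = inj₂ y<x

no-injection-into-list : ∀ {A : Set} (L : List A) {f : ℕ → A} → Injective _≡_ _≡_ f → ¬ (∀ m → f m ∈ L)
no-injection-into-list L {f} f-injective f∈L
  with pigeonhole (ℕP.n<1+n (length L)) (λ i → index (f∈L (toℕ i)))
... | i , j , i<j , same-index = Fin.<⇒≢ i<j (toℕ-injective (f-injective (begin
  f (toℕ i)                           ≡⟨ lookup-index (f∈L (toℕ i)) ⟩
  lookup L (index (f∈L (toℕ i)))      ≡⟨ cong (lookup L) same-index ⟩
  lookup L (index (f∈L (toℕ j)))      ≡⟨ lookup-index (f∈L (toℕ j)) ⟨
  f (toℕ j)                           ∎)))
  where open ≡-Reasoning

data Region : Set where
  left middle right : Region

data _⊏_ : Region → Region → Set where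
  left⊏middle  : left ⊏ middle
  left⊏right   : left ⊏ right
  middle⊏right : middle ⊏ right

region-trichotomy : ∀ r s → r ⊏ s ⊎ r ≡ s ⊎ s ⊏ r
region-trichotomy left   left   = inj₂ (inj₁ refl)
region-trichotomy left   middle = inj₁ left⊏middle
region-trichotomy left   right  = inj₁ left⊏right
region-trichotomy middle left   = inj₂ (inj₂ left⊏middle)
region-trichotomy middle middle = inj₂ (inj₁ refl)
region-trichotomy middle right  = inj₁ middle⊏right
region-trichotomy right  left   = inj₂ (inj₂ left⊏right)
region-trichotomy right  middle = inj₂ (inj₂ middle⊏right)
region-trichotomy right  right  = inj₂ (inj₁ refl)

module TITOProperties {n : ℕ} {{_ : ℕ.NonZero n}} {c : ℤ → ℤ} {_≺_ : ℤ → ℤ → Set}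
                      (tito : IsTITO n c _≺_) where
  open IsTITO tito
  open Congruence n using (Cong⇒≋; congruent-above; transposition-view; at-p; at-q; fixed; transp-at-p)
  open IsStrictTotalOrder strictTotal public
    using (compare) renaming (trans to ≺-trans; asym to ≺-asym; _<?_ to _≺?_)

  private variable x y : ℤ

  N : ℤ
  N = + n

  0<N : 0ℤ < N
  0<N = ℤ.+<+ (ℕ.>-nonZero⁻¹ n)

  ≺-irrefl : ¬ x ≺ x
  ≺-irrefl = IsStrictTotalOrder.irrefl strictTotal refl

  ≺-connex : x ≢ y → ¬ y ≺ x → x ≺ y
  ≺-connex {x} {y} x≢y y⊀x with compare x y
  ... | tri< x≺y _ _ = x≺y
  ... | tri≈ _ x≡y _ = contradiction x≡y x≢y
  ... | tri> _ _ y≺x = contradiction y≺x y⊀x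

  +N-step : ∀ x m → x + + m * N + N ≡ x + + suc m * N
  +N-step x m = ring x (+ m) N
    where ring : ∀ x k d → x + k * d + d ≡ x + (1ℤ + k) * d
          ring = solve-∀

  ≺-shift⁺ : ∀ m {x y} → x ≺ y → (x + + m * N) ≺ (y + + m * N)
  ≺-shift⁺ zero    {x} {y} x≺y = subst₂ _≺_ (sym (ℤP.+-identityʳ x)) (sym (ℤP.+-identityʳ y)) x≺y
  ≺-shift⁺ (suc m) {x} {y} x≺y =
    subst₂ _≺_ (+N-step x m) (+N-step y m) (proj₁ (translate _ _) (≺-shift⁺ m x≺y))

  ≺-unshift⁺ : ∀ m {x y} → (x + + m * N) ≺ (y + + m * N) → x ≺ y
  ≺-unshift⁺ zero    {x} {y} x≺y = subst₂ _≺_ (ℤP.+-identityʳ x) (ℤP.+-identityʳ y) x≺y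
  ≺-unshift⁺ (suc m) {x} {y} x≺y =
    ≺-unshift⁺ m (proj₂ (translate _ _) (subst₂ _≺_ (sym (+N-step x m)) (sym (+N-step y m)) x≺y))

  private
    shift-cancel : ∀ x d → x + d * N + (- d) * N ≡ x
    shift-cancel x d = ring x d N
      where ring : ∀ x k d → x + k * d + (- k) * d ≡ x
            ring = solve-∀

  ≺-shift : ∀ d {x y} → x ≺ y → (x + d * N) ≺ (y + d * N)
  ≺-shift (+ m)     = ≺-shift⁺ m
  ≺-shift -[1+ m ] {x} {y} x≺y =
    ≺-unshift⁺ (suc m) (subst₂ _≺_ (sym (shift-cancel x -[1+ m ])) (sym (shift-cancel y -[1+ m ])) x≺y)

  ≺-move-right : ∀ d {x y} → (x + d * N) ≺ y → x ≺ (y + (- d) * N)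
  ≺-move-right d {x} x+dN≺y = subst (_≺ _) (shift-cancel x d) (≺-shift (- d) x+dN≺y)

  ≺-move-left : ∀ d {x y} → x ≺ (y + d * N) → (x + (- d) * N) ≺ y
  ≺-move-left d {y = y} x≺y+dN = subst (_ ≺_) (shift-cancel y d) (≺-shift (- d) x≺y+dN)

  covers-shift : ∀ d {x y} → Covers n c _≺_ y x → Covers n c _≺_ (y + d * N) (x + d * N)
  covers-shift d (y≺x , nothing-between) = ≺-shift d y≺x , λ z (y+dN≺z , z≺x+dN) →
    nothing-between (z + (- d) * N) (≺-move-right d y+dN≺z , ≺-move-left d z≺x+dN)

  private
    N-once : ∀ x → x + N ≡ x + + 1 * N
    N-once x = cong (λ d → x + d) (sym (ℤP.*-identityˡ N))

  waxing-iterate : x ≺ (x + N) → ∀ m → x ≺ (x + + suc m * N)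
  waxing-iterate {x} x↑ zero    = subst (x ≺_) (N-once x) x↑
  waxing-iterate {x} x↑ (suc m) =
    ≺-trans x↑ (subst ((x + N) ≺_) (+N-step x (suc m)) (proj₁ (translate _ _) (waxing-iterate x↑ m)))

  waning-iterate : (x + N) ≺ x → ∀ m → (x + + suc m * N) ≺ x
  waning-iterate {x} x↓ zero    = subst (_≺ x) (N-once x) x↓
  waning-iterate {x} x↓ (suc m) =
    ≺-trans (subst (_≺ (x + N)) (+N-step x (suc m)) (proj₁ (translate _ _) (waning-iterate x↓ m))) x↓

  no-cover-by-translate : ∀ m {x} → ¬ Covers n c _≺_ (x + + suc m * N) x
  no-cover-by-translate zero    {x} cov =
    noCover x (subst (λ y → Covers n c _≺_ y x) (sym (N-once x)) cov)
  no-cover-by-translate (suc m) {x} cov@(k≺x , nothing-between) with compare x (x + N)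
  ... | tri< x↑ _ _ = ≺-asym k≺x (waxing-iterate x↑ (suc m))
  ... | tri≈ _ x≡x+N _ = ℤP.<-irrefl x≡x+N (i<i+j x 0<N)
  ... | tri> _ _ x↓ with compare (x + N) (x + + suc (suc m) * N)
  ...   | tri< x+N≺k _ _ = ≺-asym (waning-iterate x↓ m)
                            (proj₂ (translate _ _) (subst ((x + N) ≺_) (sym (+N-step x (suc m))) x+N≺k))
  ...   | tri≈ _ x+N≡k _ = noCover x (subst (λ y → Covers n c _≺_ y x) (sym x+N≡k) cov)
  ...   | tri> _ _ k≺x+N = nothing-between (x + N) (k≺x+N , x↓)

  cover-not-congruent : x < y → Covers n c _≺_ y x → ¬ Cong n x y
  cover-not-congruent {x} x<y cov x≡y with congruent-above x<y x≡y
  ... | m , refl = no-cover-by-translate m cov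

  covers-translate : ∀ {p p′ q′} → Cong n p p′ → Covers n c _≺_ q′ p′ → Covers n c _≺_ (p + (q′ - p′)) p
  covers-translate {p} {p′} {q′} p≡p′ cov′ with Cong⇒≋ p p′ p≡p′
  ... | divides d p-p′≡dN =
    subst₂ (Covers n c _≺_) (trans (shifted q′) (ring₁ q′ p p′)) (trans (shifted p′) (ring₂ p p′))
           (covers-shift d cov′)
    where
      shifted : ∀ y → y + d * N ≡ y + (p - p′)
      shifted y = cong (λ e → y + e) (sym p-p′≡dN)
      ring₁ : ∀ y p p′ → y + (p - p′) ≡ p + (y - p′)
      ring₁ = solve-∀
      ring₂ : ∀ p p′ → p′ + (p - p′) ≡ p
      ring₂ = solve-∀

  transposition-cover : ∀ {p q} → p < q → InCov n c _≺_ (transp n p q) → Covers n c _≺_ q p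
  transposition-cover {p} {q} p<q (p′ , q′ , (p′<q′ , _ , cov′) , same-map)
    with transp n p′ q′ p | transposition-view p′ q′ p | trans (sym (transp-at-p p q)) (same-map p)
  ... | _ | at-p p≡p′ | refl = covers-translate p≡p′ cov′
  ... | _ | at-q _    | refl = contradiction p<q (ℤP.<-asym (i+j<i p (i<j⇒i-j<0 p′<q′)))
  ... | _ | fixed _   | refl = contradiction p<q (ℤP.<-irrefl refl)

  sameBlock-refl : ∀ x → SameBlock n c _≺_ x x
  sameBlock-refl x = [] , λ { z (inj₁ (x≺z , z≺x)) → contradiction z≺x (≺-asym x≺z)
                            ; z (inj₂ (x≺z , z≺x)) → contradiction z≺x (≺-asym x≺z) }

  sameBlock-sym : SameBlock n c _≺_ x y → SameBlock n c _≺_ y x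
  sameBlock-sym (L , inL) = L , λ { z (inj₁ between) → inL z (inj₂ between)
                                  ; z (inj₂ between) → inL z (inj₁ between) }

  sameBlock-trans : ∀ {x y z} → SameBlock n c _≺_ x y → SameBlock n c _≺_ y z → SameBlock n c _≺_ x z
  sameBlock-trans {x} {y} {z} (L , inL) (M , inM) = L ++ y ∷ M , bounded
    where
      bounded : ∀ t → Between n c _≺_ x z t → t ∈ L ++ y ∷ M
      bounded t between with compare t y | between
      ... | tri≈ _ refl _ | _                 = ∈-++⁺ʳ L (here refl)
      ... | tri< t≺y _ _ | inj₁ (x≺t , _)     = ∈-++⁺ˡ (inL t (inj₁ (x≺t , t≺y)))
      ... | tri< t≺y _ _ | inj₂ (z≺t , _)     = ∈-++⁺ʳ L (there (inM t (inj₂ (z≺t , t≺y))))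
      ... | tri> _ _ y≺t | inj₁ (_ , t≺z)     = ∈-++⁺ʳ L (there (inM t (inj₁ (y≺t , t≺z))))
      ... | tri> _ _ y≺t | inj₂ (_ , t≺x)     = ∈-++⁺ˡ (inL t (inj₂ (y≺t , t≺x)))

  sameBlock-between : ∀ {x y z} → SameBlock n c _≺_ x y → Between n c _≺_ x y z → SameBlock n c _≺_ x z
  sameBlock-between (L , inL) (inj₁ (x≺z , z≺y)) = L , λ
    { t (inj₁ (x≺t , t≺z)) → inL t (inj₁ (x≺t , ≺-trans t≺z z≺y))
    ; t (inj₂ (z≺t , t≺x)) → contradiction (≺-trans z≺t t≺x) (≺-asym x≺z) }
  sameBlock-between (L , inL) (inj₂ (y≺z , z≺x)) = L , λ
    { t (inj₁ (x≺t , t≺z)) → contradiction (≺-trans x≺t t≺z) (≺-asym z≺x)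
    ; t (inj₂ (z≺t , t≺x)) → inL t (inj₂ (≺-trans y≺z z≺t , t≺x)) }

  Waning : ℤ → Set
  Waning x = (x + N) ≺ x

  translates-injective : ∀ x {f : ℕ → ℤ} → Injective _≡_ _≡_ f → Injective _≡_ _≡_ (λ m → x + f m * N)
  translates-injective x {f} f-injective {a} {b} same =
    f-injective (ℤP.*-cancelʳ-≡ (f a) (f b) N (+-cancelˡ x _ _ same))

  -- x and y would have infinitely many elements between them: the translates
  -- x + kN (if x ≺ y) or y - kN (if y ≺ x), k ≥ 1.
  waxing-waning-apart : x ≺ (x + N) → Waning y → ¬ SameBlock n c _≺_ x y
  waxing-waning-apart {x} {y} x↑ y↓ (L , inL) with compare x y
  ... | tri< x≺y _ _ =
    no-injection-into-list L (translates-injective x (ℕP.suc-injective ∘ ℤP.+-injective)) λ m →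
      inL _ (inj₁ (waxing-iterate x↑ m , ≺-trans (≺-shift (+ suc m) x≺y) (waning-iterate y↓ m)))
  ... | tri≈ _ refl _ = ≺-asym x↑ y↓
  ... | tri> _ _ y≺x =
    no-injection-into-list L (translates-injective y (ℕP.suc-injective ∘ ℤP.+-injective ∘ ℤP.neg-injective)) λ m →
      inL _ (inj₂ (≺-move-right (+ suc m) (waning-iterate y↓ m) ,
                   ≺-trans (≺-shift (- + suc m) y≺x) (≺-move-left (+ suc m) (waxing-iterate x↑ m))))

  waning⇒blockWaning : Waning x → BlockWaning n c _≺_ x
  waning⇒blockWaning {x} x↓ y x∼y with compare (y + N) y
  ... | tri< y↓ _ _ = y↓
  ... | tri≈ _ y+N≡y _ = contradiction (sym y+N≡y) (ℤP.<⇒≢ (i<i+j y 0<N))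
  ... | tri> _ _ y↑ = contradiction (sameBlock-sym x∼y) (waxing-waning-apart y↑ x↓)

  blockWaning⇒waning : BlockWaning n c _≺_ x → Waning x
  blockWaning⇒waning {x} x⇓ = x⇓ x (sameBlock-refl x)

  waning-+N : Waning x → Waning (x + N)
  waning-+N x↓ = proj₁ (translate _ _) x↓

  blockWaxing⇒¬waning : BlockWaxing n c _≺_ x → ¬ Waning x
  blockWaxing⇒¬waning x⇑ = x⇑ ∘ waning⇒blockWaning

  module Regions (w : ℤ) (w⇓ : BlockWaning n c _≺_ w)
                 (classify : ∀ x → ¬ SameBlock n c _≺_ w x →
                             LeftBlockElt n c _≺_ w x ⊎ RightBlockElt n c _≺_ w x) where

    InRegion : Region → ℤ → Set
    InRegion left   = LeftBlockElt n c _≺_ w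
    InRegion middle = SameBlock n c _≺_ w
    InRegion right  = RightBlockElt n c _≺_ w

    Profile : Region → ℤ → Set
    Profile left   x = ¬ Waning x × Lc n c _≺_ x
    Profile middle x = Waning x
    Profile right  x = ¬ Waning x × Rc n c _≺_ x

    region-profile : ∀ r {x} → InRegion r x → Profile r x
    region-profile left   (_ , x∈L , x⇑ , _) = blockWaxing⇒¬waning x⇑ , x∈L
    region-profile middle w∼x                = w⇓ _ w∼x
    region-profile right  (_ , x∈R , x⇑ , _) = blockWaxing⇒¬waning x⇑ , x∈R

    waxing-not-middle : BlockWaxing n c _≺_ x → ¬ SameBlock n c _≺_ w x
    waxing-not-middle x⇑ w∼x = blockWaxing⇒¬waning x⇑ (w⇓ _ w∼x)

    -- Membership of the waning block is not decidable, so regions exist only up to ¬ ¬.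
    region : ∀ x → ¬ ¬ ∃ λ r → InRegion r x
    region x no-region = ¬¬-excluded-middle λ
      { (yes w∼x) → no-region (middle , w∼x)
      ; (no w≁x)  → no-region ([ (left ,_) , (right ,_) ]′ (classify x w≁x)) }

    region-order : ∀ {r s x y} → r ⊏ s → InRegion r x → InRegion s y → x ≺ y
    region-order {x = x} {y} left⊏middle (x≺w , _ , x⇑ , _) w∼y with compare x y
    ... | tri< x≺y _ _ = x≺y
    ... | tri≈ _ refl _ = contradiction w∼y (waxing-not-middle x⇑)
    ... | tri> _ _ y≺x = contradiction (sameBlock-between w∼y (inj₂ (y≺x , x≺w))) (waxing-not-middle x⇑)
    region-order {x = x} {y} middle⊏right w∼x (w≺y , _ , y⇑ , _) with compare x y
    ... | tri< x≺y _ _ = x≺y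
    ... | tri≈ _ refl _ = contradiction w∼x (waxing-not-middle y⇑)
    ... | tri> _ _ y≺x = contradiction (sameBlock-between w∼x (inj₁ (w≺y , y≺x))) (waxing-not-middle y⇑)
    region-order left⊏right (x≺w , _) (w≺y , _) = ≺-trans x≺w w≺y

    region-sameBlock : ∀ r {x y} → InRegion r x → InRegion r y → SameBlock n c _≺_ x y
    region-sameBlock left   (_ , _ , _ , gather) (y≺w , _ , y⇑ , _) =
      gather _ y≺w (waxing-not-middle y⇑ ∘ sameBlock-sym)
    region-sameBlock middle w∼x w∼y = sameBlock-trans (sameBlock-sym w∼x) w∼y
    region-sameBlock right  (_ , _ , _ , gather) (w≺y , _ , y⇑ , _) =
      gather _ w≺y (waxing-not-middle y⇑ ∘ sameBlock-sym)

    waning⇒¬¬middle : Waning x → ¬ ¬ SameBlock n c _≺_ w x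
    waning⇒¬¬middle x↓ w≁x with classify _ w≁x
    ... | inj₁ x∈left  = proj₁ (region-profile left x∈left) x↓
    ... | inj₂ x∈right = proj₁ (region-profile right x∈right) x↓

  waning-¬¬sameBlock : SingleWaxingBlock n c _≺_ ⊎ ThreeBlocks n c _≺_ → Waning x → Waning y →
                       ¬ ¬ SameBlock n c _≺_ x y
  waning-¬¬sameBlock (inj₁ (connected , _)) _ _ = λ x≁y → x≁y (connected _ _)
  waning-¬¬sameBlock (inj₂ (w , w⇓ , _ , _ , classify)) x↓ y↓ = do
    w∼x ← waning⇒¬¬middle x↓
    w∼y ← waning⇒¬¬middle y↓
    pure (sameBlock-trans (sameBlock-sym w∼x) w∼y)
    where open Regions w w⇓ classify
          open RawMonad ¬¬-Monad

module Transfer {n : ℕ} {{_ : ℕ.NonZero n}} {c : ℤ → ℤ} {_≺P_ _≺Q_ : ℤ → ℤ → Set}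
                (titoP : IsTITO n c _≺P_) (titoQ : IsTITO n c _≺Q_)
                (moves : ∀ x → x < c x ⊎ c x < x)
                (cond2P : Cond2 n c _≺P_) (cond2Q : Cond2 n c _≺Q_)
                (Cov⊆ : ∀ t → InCov n c _≺P_ t → InCov n c _≺Q_ t) where
  module P = TITOProperties titoP
  module Q = TITOProperties titoQ

  cover-transfer : ∀ {u v} → v < u → Covers n c _≺P_ u v → Covers n c _≺Q_ u v
  cover-transfer {u} {v} v<u cov = Q.transposition-cover v<u (Cov⊆ (transp n v u) (v , u , cov-pair , λ _ → refl))
    where
      cov-pair : CovPair n c _≺P_ v u
      cov-pair = v<u , P.cover-not-congruent v<u cov , cov

  inversion-below : ∀ {z v u} → z < v → v < u → u ≺P z → z ≺P v → u ≺Q z → u ≺Q v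
  inversion-below {z} {v} {u} z<v v<u u≺z z≺v u≺z-in-Q =
    Q.≺-connex (ℤP.<⇒≢ v<u ∘ sym) λ v≺u-in-Q → proj₂ (cond2Q z v u z<v v<u) (v≺u-in-Q , u≺z-in-Q , v∈R)
    where
      v∈R : c v < v
      v∈R = [ (λ v∈L → contradiction (u≺z , z≺v , v∈L) (proj₁ (cond2P z v u z<v v<u))) , id ]′ (moves v)

  inversion-above : ∀ {v u z} → v < u → u < z → u ≺P z → z ≺P v → z ≺Q v → u ≺Q v
  inversion-above {v} {u} {z} v<u u<z u≺z z≺v z≺v-in-Q =
    Q.≺-connex (ℤP.<⇒≢ v<u ∘ sym) λ v≺u-in-Q → proj₁ (cond2Q v u z v<u u<z) (z≺v-in-Q , v≺u-in-Q , u∈L)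
    where
      u∈L : u < c u
      u∈L = [ id , (λ u∈R → contradiction (u≺z , z≺v , u∈R) (proj₂ (cond2P v u z v<u u<z))) ]′ (moves u)

  inversion-via : ∀ {u v z} → v < u → u ≺P z → z ≺P v → (z < u → u ≺Q z) → (v < z → z ≺Q v) → u ≺Q v
  inversion-via {u} {v} {z} v<u u≺z z≺v via-left via-right with ℤP.<-cmp z v
  ... | tri< z<v _ _ = inversion-below z<v v<u u≺z z≺v (via-left (ℤP.<-trans z<v v<u))
  ... | tri≈ _ refl _ = contradiction z≺v P.≺-irrefl
  ... | tri> _ _ v<z with ℤP.<-cmp z u
  ...   | tri< z<u _ _ = Q.≺-trans (via-left z<u) (via-right v<z)
  ...   | tri≈ _ refl _ = contradiction u≺z P.≺-irrefl
  ...   | tri> _ _ u<z = inversion-above v<u u<z u≺z z≺v (via-right v<z)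

  inversion-transfer-within : ∀ (L : List ℤ) {u v} → v < u → u ≺P v →
                              (∀ z → u ≺P z → z ≺P v → z ∈ L) → u ≺Q v
  inversion-transfer-within [] v<u u≺v inL =
    proj₁ (cover-transfer v<u (u≺v , λ z (u≺z , z≺v) → case inL z u≺z z≺v of λ ()))
  inversion-transfer-within (z ∷ L) {u} {v} v<u u≺v inL with (u P.≺? z) ×-dec (z P.≺? v)
  ... | no z-outside = inversion-transfer-within L v<u u≺v λ t u≺t t≺v →
        tail (λ { refl → z-outside (u≺t , t≺v) }) (inL t u≺t t≺v)
  ... | yes (u≺z , z≺v) = inversion-via v<u u≺z z≺v
        (λ z<u → inversion-transfer-within L z<u u≺z λ t u≺t t≺z →
           tail (λ { refl → P.≺-irrefl t≺z }) (inL t u≺t (P.≺-trans t≺z z≺v)))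
        (λ v<z → inversion-transfer-within L v<z z≺v λ t z≺t t≺v →
           tail (λ { refl → P.≺-irrefl z≺t }) (inL t (P.≺-trans u≺z z≺t) t≺v))

  inversion-transfer : ∀ {u v} → v < u → u ≺P v → SameBlock n c _≺P_ u v → u ≺Q v
  inversion-transfer v<u u≺v (L , inL) =
    inversion-transfer-within L v<u u≺v λ z u≺z z≺v → inL z (inj₁ (u≺z , z≺v))

  waning-transfer : SingleWaxingBlock n c _≺P_ ⊎ ThreeBlocks n c _≺P_ → ∀ {x} → P.Waning x → Q.Waning x
  waning-transfer blocks {x} x↓ = decidable-stable ((x + P.N) Q.≺? x)
    (¬¬-map (inversion-transfer (i<i+j x P.0<N) x↓) (P.waning-¬¬sameBlock blocks (P.waning-+N x↓) x↓))

module SortableTransfer {n : ℕ} {{_ : ℕ.NonZero n}} {c : ℤ → ℤ} {_≺P_ _≺Q_ : ℤ → ℤ → Set}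
                        (titoP : IsTITO n c _≺P_) (titoQ : IsTITO n c _≺Q_)
                        (moves : ∀ x → x < c x ⊎ c x < x)
                        (sortableP : Sortable n c _≺P_) (sortableQ : Sortable n c _≺Q_)
                        (Cov⊆ : ∀ t → InCov n c _≺P_ t → InCov n c _≺Q_ t)
                        (Cov⊇ : ∀ t → InCov n c _≺Q_ t → InCov n c _≺P_ t) where
  module P = TITOProperties titoP
  module Q = TITOProperties titoQ
  module PQ = Transfer titoP titoQ moves (proj₂ sortableP) (proj₂ sortableQ) Cov⊆
  module QP = Transfer titoQ titoP moves (proj₂ sortableQ) (proj₂ sortableP) Cov⊇

  three-blocks-inversion : ThreeBlocks n c _≺P_ → ThreeBlocks n c _≺Q_ →
                           ∀ {a b} → a < b → b ≺P a → ¬ ¬ (b ≺Q a)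
  three-blocks-inversion threeP@(wP , wP⇓ , _ , _ , classifyP) threeQ@(wQ , wQ⇓ , _ , _ , classifyQ)
                         {a} {b} a<b b≺a = do
      r , b∈r-in-P , b∈r-in-Q ← common-region b
      s , a∈s-in-P , a∈s-in-Q ← common-region a
      pure (compare-regions (region-trichotomy r s) b∈r-in-P b∈r-in-Q a∈s-in-P a∈s-in-Q)
    where
      module RP = P.Regions wP wP⇓ classifyP
      module RQ = Q.Regions wQ wQ⇓ classifyQ
      open RawMonad ¬¬-Monad

      profiles-agree : ∀ r s {x} → RP.Profile r x → RQ.Profile s x → r ≡ s
      profiles-agree left   left   _ _ = refl
      profiles-agree middle middle _ _ = refl
      profiles-agree right  right  _ _ = refl
      profiles-agree left   middle (x↑ , _) x↓ = contradiction (QP.waning-transfer (inj₂ threeQ) x↓) x↑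
      profiles-agree right  middle (x↑ , _) x↓ = contradiction (QP.waning-transfer (inj₂ threeQ) x↓) x↑
      profiles-agree middle left   x↓ (x↑ , _) = contradiction (PQ.waning-transfer (inj₂ threeP) x↓) x↑
      profiles-agree middle right  x↓ (x↑ , _) = contradiction (PQ.waning-transfer (inj₂ threeP) x↓) x↑
      profiles-agree left   right  (_ , x∈L) (_ , x∈R) = contradiction x∈R (ℤP.<-asym x∈L)
      profiles-agree right  left   (_ , x∈R) (_ , x∈L) = contradiction x∈R (ℤP.<-asym x∈L)

      common-region : ∀ x → ¬ ¬ ∃ λ r → RP.InRegion r x × RQ.InRegion r x
      common-region x = do
        r , x∈r ← RP.region x
        s , x∈s ← RQ.region x
        let r≡s = profiles-agree r s (RP.region-profile r x∈r) (RQ.region-profile s x∈s)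
        pure (r , x∈r , subst (λ t → RQ.InRegion t x) (sym r≡s) x∈s)

      compare-regions : ∀ {r s} → r ⊏ s ⊎ r ≡ s ⊎ s ⊏ r → RP.InRegion r b → RQ.InRegion r b →
                        RP.InRegion s a → RQ.InRegion s a → b ≺Q a
      compare-regions (inj₁ r⊏s) _ b∈Q _ a∈Q = RQ.region-order r⊏s b∈Q a∈Q
      compare-regions {r} (inj₂ (inj₁ refl)) b∈P _ a∈P _ =
        PQ.inversion-transfer a<b b≺a (RP.region-sameBlock r b∈P a∈P)
      compare-regions (inj₂ (inj₂ s⊏r)) b∈P _ a∈P _ =
        contradiction (RP.region-order s⊏r a∈P b∈P) (P.≺-asym b≺a)

  inversion-transfer : ∀ {a b} → a < b → b ≺P a → b ≺Q a
  inversion-transfer a<b b≺a with proj₁ sortableP | proj₁ sortableQ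
  ... | inj₁ (connected , _) | _ = PQ.inversion-transfer a<b b≺a (connected _ _)
  ... | inj₂ threeP@(w , w⇓ , _) | inj₁ (_ , all-waxing) =
        contradiction (Q.waning⇒blockWaning (PQ.waning-transfer (inj₂ threeP) (P.blockWaning⇒waning w⇓)))
                      (all-waxing w)
  ... | inj₂ threeP | inj₂ threeQ =
        decidable-stable (_ Q.≺? _) (three-blocks-inversion threeP threeQ a<b b≺a)

inversions-determine-order : ∀ {_≺₁_ _≺₂_ : ℤ → ℤ → Set} →
  IsStrictTotalOrder _≡_ _≺₁_ → IsStrictTotalOrder _≡_ _≺₂_ →
  (∀ {a b} → a < b → b ≺₁ a → b ≺₂ a) → (∀ {a b} → a < b → b ≺₂ a → b ≺₁ a) →
  ∀ {x y} → x ≺₁ y → x ≺₂ y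
inversions-determine-order sto₁ sto₂ inv₁⊆inv₂ inv₂⊆inv₁ {x} {y} x≺₁y
  with IsStrictTotalOrder.compare sto₂ x y
... | tri< x≺₂y _ _ = x≺₂y
... | tri≈ _ refl _ = contradiction x≺₁y (IsStrictTotalOrder.irrefl sto₁ refl)
... | tri> _ _ y≺₂x with ℤP.<-cmp x y
...   | tri< x<y _ _ = contradiction (inv₂⊆inv₁ x<y y≺₂x) (IsStrictTotalOrder.asym sto₁ x≺₁y)
...   | tri≈ _ refl _ = contradiction x≺₁y (IsStrictTotalOrder.irrefl sto₁ refl)
...   | tri> _ _ y<x = inv₁⊆inv₂ y<x x≺₁y

InCov-transport : ∀ {n c} {_≺₁_ _≺₂_ : ℤ → ℤ → Set} →
                  (∀ {x y} → x ≺₁ y → x ≺₂ y) → (∀ {x y} → x ≺₂ y → x ≺₁ y) →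
                  ∀ t → InCov n c _≺₁_ t → InCov n c _≺₂_ t
InCov-transport ≺₁⊆≺₂ ≺₂⊆≺₁ t (p , q , (p<q , p≢q , (q≺p , nothing-between)) , t≗) =
  p , q , (p<q , p≢q , (≺₁⊆≺₂ q≺p , λ z (q≺z , z≺p) → nothing-between z (≺₂⊆≺₁ q≺z , ≺₂⊆≺₁ z≺p))) , t≗

InCov-resp-⇔ : ∀ n c {_≺₁_ _≺₂_ : ℤ → ℤ → Set} → (∀ x y → (x ≺₁ y) ⇔ (x ≺₂ y)) →
               ∀ t → InCov n c _≺₁_ t ⇔ InCov n c _≺₂_ t
InCov-resp-⇔ n c {_≺₁_} {_≺₂_} ≺₁⇔≺₂ t =
  mk⇔ (InCov-transport {n} {c} ≺₁⊆≺₂ ≺₂⊆≺₁ t) (InCov-transport {n} {c} ≺₂⊆≺₁ ≺₁⊆≺₂ t)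
  where
    ≺₁⊆≺₂ : ∀ {x y} → x ≺₁ y → x ≺₂ y
    ≺₁⊆≺₂ = Equivalence.to (≺₁⇔≺₂ _ _)
    ≺₂⊆≺₁ : ∀ {x y} → x ≺₂ y → x ≺₁ y
    ≺₂⊆≺₁ = Equivalence.from (≺₁⇔≺₂ _ _)

sortable-order-from-Cov : ∀ {n} {{_ : ℕ.NonZero n}} {c} {_≺₁_ _≺₂_ : ℤ → ℤ → Set} →
  (∀ x → x < c x ⊎ c x < x) → IsTITO n c _≺₁_ → IsTITO n c _≺₂_ → Sortable n c _≺₁_ → Sortable n c _≺₂_ →
  (∀ t → InCov n c _≺₁_ t ⇔ InCov n c _≺₂_ t) → ∀ x y → (x ≺₁ y) ⇔ (x ≺₂ y)
sortable-order-from-Cov {n} {c = c} {_≺₁_} {_≺₂_} moves tito₁ tito₂ sortable₁ sortable₂ Cov₁⇔Cov₂ x y =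
  mk⇔ (inversions-determine-order order₁ order₂ T₁₂.inversion-transfer T₂₁.inversion-transfer)
      (inversions-determine-order order₂ order₁ T₂₁.inversion-transfer T₁₂.inversion-transfer)
  where
    order₁ : IsStrictTotalOrder _≡_ _≺₁_
    order₁ = IsTITO.strictTotal tito₁
    order₂ : IsStrictTotalOrder _≡_ _≺₂_
    order₂ = IsTITO.strictTotal tito₂
    Cov₁⊆Cov₂ : ∀ t → InCov n c _≺₁_ t → InCov n c _≺₂_ t
    Cov₁⊆Cov₂ t = Equivalence.to (Cov₁⇔Cov₂ t)
    Cov₂⊆Cov₁ : ∀ t → InCov n c _≺₂_ t → InCov n c _≺₁_ t
    Cov₂⊆Cov₁ t = Equivalence.from (Cov₁⇔Cov₂ t)
    module T₁₂ = SortableTransfer tito₁ tito₂ moves sortable₁ sortable₂ Cov₁⊆Cov₂ Cov₂⊆Cov₁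
    module T₂₁ = SortableTransfer tito₂ tito₁ moves sortable₂ sortable₁ Cov₂⊆Cov₁ Cov₁⊆Cov₂

proposition3p3 : (n : ℕ) → 2 ≤ n → (w : List (Fin n)) → w ↭ allFin n →
    (_≺₁_ _≺₂_ : ℤ → ℤ → Set) →
    IsTITO n (wordPerm n w) _≺₁_ → IsTITO n (wordPerm n w) _≺₂_ →
    Sortable n (wordPerm n w) _≺₁_ → Sortable n (wordPerm n w) _≺₂_ →
    ((∀ x y → (x ≺₁ y) ⇔ (x ≺₂ y)) ⇔
     (∀ (t : ℤ → ℤ) → InCov n (wordPerm n w) _≺₁_ t ⇔ InCov n (wordPerm n w) _≺₂_ t))
proposition3p3 n@(suc _) _ w w↭ _≺₁_ _≺₂_ tito₁ tito₂ sortable₁ sortable₂ =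
  mk⇔ (InCov-resp-⇔ n (wordPerm n w))
      (sortable-order-from-Cov (Coxeter.coxeter-moves n w↭) tito₁ tito₂ sortable₁ sortable₂)
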